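{- Let $A_n$ denote the number of ways to tile an $n$-board using squares and $(1,1)$-fences. Then for all integers $n\ge 0$, \[ A_{2n}=f_n^2,\qquad A_{2n+1}=f_nf_{n+1}, \] where $f_n=F_{n+1}$ and $F_m$ is the $m$th Fibonacci number.
   Context: An $n$-board is a $1\times n$ row of $n$ unit cells. A square is a $1\times1$ tile covering one cell. A $(1,1)$-fence is a tile made of two $1\times1$ subtiles (posts) separated by a gap of width one cell; when placed on a board its posts occupy cells $i$ and $i+2$ for some $i$, and the gap cell $i+1$ is not covered by the fence (it must be covered by some other tile, e.g. a square or a post of another fence). A tiling of an $n$-board is a placement of tiles covering every cell exactly once. The empty $0$-board has exactly one tiling, so $A_0=1$. Fibonacci numbers: $F_0=0$, $F_1=1$, $F_m=F_{m-1}+F_{m-2}$ for $m\ge2$. -}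

module Defs where

open import Data.Nat using (ℕ; zero; suc; _+_; _*_; _≡ᵇ_; _<ᵇ_)
open import Data.Bool using (Bool; true; false; _∧_; if_then_else_)
open import Data.List using (List; []; _∷_; map; concatMap; filter; length; upTo)
open import Data.Bool.ListAction using (all)
open import Data.Vec using (Vec; []; _∷_)
open import Data.Fin.Subset using (Subset)
open import Data.Product using (_×_; _,_)
open import Data.Bool.Properties using (T?)

F : ℕ → ℕ
F zero = 0
F (suc zero) = 1
F (suc (suc m)) = F (suc m) + F m

f : ℕ → ℕ
f n = F (suc n)

-- membership of the cell with (0-based) index i in a subset of the cells of
-- an n-board; indices ≥ n are never members.
_∈?_ : {n : ℕ} → ℕ → Subset n → Bool
_∈?_ {zero} i [] = false
_∈?_ {suc n} zero (b ∷ s) = b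
_∈?_ {suc n} (suc i) (b ∷ s) = i ∈? s

count : Bool → ℕ
count true = 1
count false = 0

-- A placement of tiles on an n-board (cells 0,…,n-1) is a pair (S , P) of
-- subsets of the cells: S = cells carrying a square, P = cells i carrying the
-- left post of a (1,1)-fence (whose posts are at i and i+2).
coverage : {n : ℕ} → Subset n → Subset n → ℕ → ℕ
coverage S P j = count (j ∈? S) + count (j ∈? P) + rightPost j
  where
  rightPost : ℕ → ℕ
  rightPost (suc (suc i)) = count (i ∈? P)
  rightPost _ = 0

isTiling : {n : ℕ} → Subset n × Subset n → Bool
isTiling {n} (S , P) =
  all (λ i → if i ∈? P then (i + 2) <ᵇ n else true) (upTo n)
  ∧ all (λ j → coverage S P j ≡ᵇ 1) (upTo n)

allSubsets : (n : ℕ) → List (Subset n)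
allSubsets zero = [] ∷ []
allSubsets (suc n) = concatMap (λ s → (true ∷ s) ∷ (false ∷ s) ∷ []) (allSubsets n)

allPlacements : (n : ℕ) → List (Subset n × Subset n)
allPlacements n = concatMap (λ S → map (λ P → S , P) (allSubsets n)) (allSubsets n)

A : ℕ → ℕ
A n = length (filter (λ t → T? (isTiling t)) (allPlacements n))

-- Let T(n, a, b) count the tilings of an n-board in which, when the flag a (resp. b)
-- is set, cell 0 (resp. 1) is already covered by the right post of a fence starting
-- at cell -2 (resp. -1).  Reading off the first cell gives the recurrences
-- T(n+1, 1, b) = T(n, b, 0) and T(n+1, 0, b) = T(n, b, 0) + T(n, b, 1): the cells of
-- even and of odd index are tiled independently, each like a board of squares and
-- dominoes.  Hence T(n, a, b) is the product of two square–domino counts, on boards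
-- of lengths ⌈n/2⌉ and ⌊n/2⌋.
module Submission where

open import Defs
open import Algebra.Bundles using (CommutativeMonoid)
open import Data.Bool using (Bool; true; false; _∧_; if_then_else_)
open import Data.Bool.ListAction using (and; all)
open import Data.Bool.Properties using (T?; ∧-commutativeMonoid)
open import Data.Fin.Subset using (Subset)
open import Data.List using (List; []; _∷_; _++_; map; concatMap; filter; length; upTo)
open import Data.List.Properties using (map-cong; map-++; map-∘; map-applyUpTo; map-upTo)
open import Data.Nat using (ℕ; zero; suc; _+_; _*_; _≡ᵇ_; _<ᵇ_; ⌊_/2⌋; ⌈_/2⌉)
open import Data.Nat.ListAction using (sum)
open import Data.Nat.ListAction.Properties using (sum-++)
open import Data.Nat.Properties
  using (+-assoc; +-identityʳ; +-commutativeSemigroup; *-comm; *-distribˡ-+; n≡⌊n+n/2⌋; n≡⌈n+n/2⌉)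
open import Data.Product using (_×_; _,_)
open import Data.Vec using (_∷_)
open import Relation.Binary.PropositionalEquality
open import Algebra.Properties.CommutativeSemigroup
  (CommutativeMonoid.commutativeSemigroup ∧-commutativeMonoid) using (x∙yz≈y∙xz)
open import Algebra.Properties.CommutativeSemigroup +-commutativeSemigroup
  using () renaming (interchange to +-interchange)

open ≡-Reasoning

private
  variable
    X Y : Set

∑ : List X → (X → ℕ) → ℕ
∑ xs h = sum (map h xs)

∑-cong : {h h′ : X → ℕ} → (∀ x → h x ≡ h′ x) → (xs : List X) → ∑ xs h ≡ ∑ xs h′
∑-cong h≗h′ xs = cong sum (map-cong h≗h′ xs)

∑-+ : (h h′ : X → ℕ) (xs : List X) → ∑ xs (λ x → h x + h′ x) ≡ ∑ xs h + ∑ xs h′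
∑-+ h h′ [] = refl
∑-+ h h′ (x ∷ xs) = trans (cong ((h x + h′ x) +_) (∑-+ h h′ xs))
                          (+-interchange (h x) (h′ x) (∑ xs h) (∑ xs h′))

∑-map : (h : Y → ℕ) (k : X → Y) (xs : List X) → ∑ (map k xs) h ≡ ∑ xs (λ x → h (k x))
∑-map h k xs = cong sum (sym (map-∘ xs))

∑-concatMap : (h : Y → ℕ) (k : X → List Y) (xs : List X) →
              ∑ (concatMap k xs) h ≡ ∑ xs (λ x → ∑ (k x) h)
∑-concatMap h k [] = refl
∑-concatMap h k (x ∷ xs) = begin
  sum (map h (k x ++ concatMap k xs))         ≡⟨ cong sum (map-++ h (k x) (concatMap k xs)) ⟩
  sum (map h (k x) ++ map h (concatMap k xs)) ≡⟨ sum-++ (map h (k x)) _ ⟩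
  ∑ (k x) h + ∑ (concatMap k xs) h            ≡⟨ cong (∑ (k x) h +_) (∑-concatMap h k xs) ⟩
  ∑ (k x) h + ∑ xs (λ x → ∑ (k x) h)          ∎

length-filter-T? : (g : X → Bool) (xs : List X) →
                   length (filter (λ x → T? (g x)) xs) ≡ ∑ xs (λ x → count (g x))
length-filter-T? g [] = refl
length-filter-T? g (x ∷ xs) with g x
... | true  = cong suc (length-filter-T? g xs)
... | false = length-filter-T? g xs

∑-allSubsets-suc : (n : ℕ) (h : Subset (suc n) → ℕ) →
                   ∑ (allSubsets (suc n)) h ≡ ∑ (allSubsets n) (λ s → h (true ∷ s) + h (false ∷ s))
∑-allSubsets-suc n h = trans (∑-concatMap h _ (allSubsets n))
  (∑-cong (λ s → cong (h (true ∷ s) +_) (+-identityʳ (h (false ∷ s)))) (allSubsets n))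

∑² : (n : ℕ) → (Subset n → Subset n → ℕ) → ℕ
∑² n h = ∑ (allSubsets n) λ S → ∑ (allSubsets n) λ P → h S P

∑²-cong : (n : ℕ) {h h′ : Subset n → Subset n → ℕ} →
          (∀ S P → h S P ≡ h′ S P) → ∑² n h ≡ ∑² n h′
∑²-cong n h≗h′ = ∑-cong (λ S → ∑-cong (h≗h′ S) (allSubsets n)) (allSubsets n)

∑²-+ : (n : ℕ) (h h′ : Subset n → Subset n → ℕ) →
       ∑² n (λ S P → h S P + h′ S P) ≡ ∑² n h + ∑² n h′
∑²-+ n h h′ = trans (∑-cong (λ S → ∑-+ (h S) (h′ S) (allSubsets n)) (allSubsets n))
                    (∑-+ _ _ (allSubsets n))

∑-allPlacements : (n : ℕ) (h : Subset n × Subset n → ℕ) →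
                  ∑ (allPlacements n) h ≡ ∑² n (λ S P → h (S , P))
∑-allPlacements n h = trans (∑-concatMap h _ (allSubsets n))
  (∑-cong (λ S → ∑-map h (S ,_) (allSubsets n)) (allSubsets n))

∑²-suc : (n : ℕ) (h : Subset (suc n) → Subset (suc n) → ℕ) →
         ∑² (suc n) h ≡ ∑² n (λ S P → h (true ∷ S) (true ∷ P) + h (true ∷ S) (false ∷ P)
                                    + h (false ∷ S) (true ∷ P) + h (false ∷ S) (false ∷ P))
∑²-suc n h = begin
  ∑² (suc n) h
    ≡⟨ ∑-allSubsets-suc n _ ⟩
  ∑ (allSubsets n) (λ S → ∑ (allSubsets (suc n)) (h (true ∷ S))
                        + ∑ (allSubsets (suc n)) (h (false ∷ S)))
    ≡⟨ ∑-cong (λ S → cong₂ _+_ (∑-allSubsets-suc n _) (∑-allSubsets-suc n _)) (allSubsets n) ⟩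
  ∑ (allSubsets n) (λ S → ∑ (allSubsets n) (λ P → h (true ∷ S) (true ∷ P) + h (true ∷ S) (false ∷ P))
                        + ∑ (allSubsets n) (λ P → h (false ∷ S) (true ∷ P) + h (false ∷ S) (false ∷ P)))
    ≡⟨ ∑-cong (λ S → ∑-+ _ _ (allSubsets n)) (allSubsets n) ⟨
  ∑² n (λ S P → (h (true ∷ S) (true ∷ P) + h (true ∷ S) (false ∷ P))
              + (h (false ∷ S) (true ∷ P) + h (false ∷ S) (false ∷ P)))
    ≡⟨ ∑²-cong n (λ S P → +-assoc (h (true ∷ S) (true ∷ P) + _) _ _) ⟨
  ∑² n (λ S P → h (true ∷ S) (true ∷ P) + h (true ∷ S) (false ∷ P)
              + h (false ∷ S) (true ∷ P) + h (false ∷ S) (false ∷ P)) ∎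

all-upTo-suc : (q : ℕ → Bool) (n : ℕ) → all q (upTo (suc n)) ≡ q 0 ∧ all (λ i → q (suc i)) (upTo n)
all-upTo-suc q n = cong (λ bs → q 0 ∧ and bs)
  (trans (map-applyUpTo suc q n) (sym (map-upTo (λ i → q (suc i)) n)))

all-cong : {q q′ : ℕ → Bool} → (∀ i → q i ≡ q′ i) → (xs : List ℕ) → all q xs ≡ all q′ xs
all-cong q≗q′ xs = cong and (map-cong q≗q′ xs)

postFits : ℕ → ℕ → Bool → Bool
postFits n k b = if b then k <ᵇ n else true

postFits-zero : (n : ℕ) (b : Bool) → postFits (suc n) 0 b ≡ true
postFits-zero n true  = refl
postFits-zero n false = refl

fencesFit : {n : ℕ} → Subset n → Bool
fencesFit {n} P = all (λ i → postFits n (i + 2) (i ∈? P)) (upTo n)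

-- The flags a, b play the role of left posts at cells -2 and -1, which is why they are
-- simply prepended to P when right posts are counted.
coverageFrom : {n : ℕ} → Bool → Bool → Subset n → Subset n → ℕ → ℕ
coverageFrom a b S P j = count (j ∈? S) + count (j ∈? P) + count (j ∈? (a ∷ b ∷ P))

isTilingFrom : {n : ℕ} → Bool → Bool → Subset n × Subset n → Bool
isTilingFrom {n} a b (S , P) =
  (postFits n 0 a ∧ postFits n 1 b ∧ fencesFit P)
  ∧ all (λ j → coverageFrom a b S P j ≡ᵇ 1) (upTo n)

coverage≡coverageFrom : {n : ℕ} (S P : Subset n) (j : ℕ) →
                        coverage S P j ≡ coverageFrom false false S P j
coverage≡coverageFrom S P zero          = refl
coverage≡coverageFrom S P (suc zero)    = refl
coverage≡coverageFrom S P (suc (suc j)) = refl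

isTiling≡isTilingFrom : {n : ℕ} (S P : Subset n) → isTiling (S , P) ≡ isTilingFrom false false (S , P)
isTiling≡isTilingFrom {n} S P =
  cong (fencesFit P ∧_) (all-cong (λ j → cong (_≡ᵇ 1) (coverage≡coverageFrom S P j)) (upTo n))

isTilingFrom-∷ : {n : ℕ} (a b s p : Bool) (S P : Subset n) →
                 isTilingFrom a b (s ∷ S , p ∷ P)
                 ≡ (count s + count p + count a ≡ᵇ 1) ∧ isTilingFrom b p (S , P)
isTilingFrom-∷ {n} a b s p S P = begin
  isTilingFrom a b (s ∷ S , p ∷ P)
    ≡⟨ cong₂ (λ x y → (postFits (suc n) 0 a ∧ postFits n 0 b ∧ x) ∧ y)
             (all-upTo-suc (λ i → postFits (suc n) (i + 2) (i ∈? (p ∷ P))) n)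
             (all-upTo-suc (λ j → coverageFrom a b (s ∷ S) (p ∷ P) j ≡ᵇ 1) n) ⟩
  (postFits (suc n) 0 a ∧ fits) ∧ (firstCell ∧ covered)
    ≡⟨ cong (λ x → (x ∧ fits) ∧ (firstCell ∧ covered)) (postFits-zero n a) ⟩
  fits ∧ (firstCell ∧ covered)
    ≡⟨ x∙yz≈y∙xz fits firstCell covered ⟩
  firstCell ∧ (fits ∧ covered) ∎
  where
  fits firstCell covered : Bool
  fits      = postFits n 0 b ∧ postFits n 1 p ∧ fencesFit P
  firstCell = count s + count p + count a ≡ᵇ 1
  covered   = all (λ j → coverageFrom b p S P j ≡ᵇ 1) (upTo n)

tilingsFrom : ℕ → Bool → Bool → ℕ
tilingsFrom n a b = ∑² n (λ S P → count (isTilingFrom a b (S , P)))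

A≡tilingsFrom : (n : ℕ) → A n ≡ tilingsFrom n false false
A≡tilingsFrom n = begin
  A n                                            ≡⟨ length-filter-T? isTiling (allPlacements n) ⟩
  ∑ (allPlacements n) (λ t → count (isTiling t)) ≡⟨ ∑-allPlacements n _ ⟩
  ∑² n (λ S P → count (isTiling (S , P)))        ≡⟨ ∑²-cong n (λ S P → cong count (isTiling≡isTilingFrom S P)) ⟩
  tilingsFrom n false false                      ∎

tilingsFrom-suc : (n : ℕ) (a b : Bool) → tilingsFrom (suc n) a b ≡
  ∑² n (λ S P → count ((1 + 1 + count a ≡ᵇ 1) ∧ isTilingFrom b true (S , P))
              + count ((1 + 0 + count a ≡ᵇ 1) ∧ isTilingFrom b false (S , P))
              + count ((0 + 1 + count a ≡ᵇ 1) ∧ isTilingFrom b true (S , P))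
              + count ((0 + 0 + count a ≡ᵇ 1) ∧ isTilingFrom b false (S , P)))
tilingsFrom-suc n a b = trans (∑²-suc n _) (∑²-cong n λ S P →
  cong₂ _+_ (cong₂ _+_ (cong₂ _+_ (step true true S P) (step true false S P)) (step false true S P))
            (step false false S P))
  where
  step : (s p : Bool) (S P : Subset n) → count (isTilingFrom a b (s ∷ S , p ∷ P))
         ≡ count ((count s + count p + count a ≡ᵇ 1) ∧ isTilingFrom b p (S , P))
  step s p S P = cong count (isTilingFrom-∷ a b s p S P)

tilingsFrom-suc-true : (n : ℕ) (b : Bool) → tilingsFrom (suc n) true b ≡ tilingsFrom n b false
tilingsFrom-suc-true n b = tilingsFrom-suc n true b  -- the other three summands compute to 0

tilingsFrom-suc-false : (n : ℕ) (b : Bool) →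
                        tilingsFrom (suc n) false b ≡ tilingsFrom n b false + tilingsFrom n b true
tilingsFrom-suc-false n b =
  trans (tilingsFrom-suc n false b)
        (trans (∑²-cong n (λ S P → +-identityʳ _)) (∑²-+ n _ _))

-- The number of tilings of an m-board by squares and dominoes, where the flag records
-- that the first cell is already covered from outside.
dominoTilings : Bool → ℕ → ℕ
dominoTilings true  m = F m
dominoTilings false m = F (suc m)

tilingsFrom-closed : (n : ℕ) (a b : Bool) →
                     tilingsFrom n a b ≡ dominoTilings a ⌈ n /2⌉ * dominoTilings b ⌊ n /2⌋
tilingsFrom-closed zero true  true  = refl
tilingsFrom-closed zero true  false = refl
tilingsFrom-closed zero false true  = refl
tilingsFrom-closed zero false false = refl
tilingsFrom-closed (suc n) true b = begin
  tilingsFrom (suc n) true b                 ≡⟨ tilingsFrom-suc-true n b ⟩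
  tilingsFrom n b false                      ≡⟨ tilingsFrom-closed n b false ⟩
  dominoTilings b ⌈ n /2⌉ * F (suc ⌊ n /2⌋)  ≡⟨ *-comm (dominoTilings b _) _ ⟩
  F (suc ⌊ n /2⌋) * dominoTilings b ⌈ n /2⌉  ∎
tilingsFrom-closed (suc n) false b = begin
  tilingsFrom (suc n) false b
    ≡⟨ tilingsFrom-suc-false n b ⟩
  tilingsFrom n b false + tilingsFrom n b true
    ≡⟨ cong₂ _+_ (tilingsFrom-closed n b false) (tilingsFrom-closed n b true) ⟩
  dominoTilings b ⌈ n /2⌉ * F (suc ⌊ n /2⌋) + dominoTilings b ⌈ n /2⌉ * F ⌊ n /2⌋
    ≡⟨ *-distribˡ-+ (dominoTilings b _) _ _ ⟨
  dominoTilings b ⌈ n /2⌉ * F (suc (suc ⌊ n /2⌋))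
    ≡⟨ *-comm (dominoTilings b _) _ ⟩
  F (suc (suc ⌊ n /2⌋)) * dominoTilings b ⌈ n /2⌉ ∎

theorem2p3 : (n : ℕ) → (A (n + n) ≡ f n * f n) × (A (suc (n + n)) ≡ f n * f (suc n))
theorem2p3 n = even , odd
  where
  even : A (n + n) ≡ f n * f n
  even = begin
    A (n + n)                             ≡⟨ A≡tilingsFrom (n + n) ⟩
    tilingsFrom (n + n) false false       ≡⟨ tilingsFrom-closed (n + n) false false ⟩
    f ⌈ n + n /2⌉ * f ⌊ n + n /2⌋         ≡⟨ cong₂ (λ x y → f x * f y) (n≡⌈n+n/2⌉ n) (n≡⌊n+n/2⌋ n) ⟨
    f n * f n                             ∎
  odd : A (suc (n + n)) ≡ f n * f (suc n)
  odd = begin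
    A (suc (n + n))                       ≡⟨ A≡tilingsFrom (suc (n + n)) ⟩
    tilingsFrom (suc (n + n)) false false ≡⟨ tilingsFrom-closed (suc (n + n)) false false ⟩
    f (suc ⌊ n + n /2⌋) * f ⌈ n + n /2⌉   ≡⟨ cong₂ (λ x y → f (suc x) * f y) (n≡⌊n+n/2⌋ n) (n≡⌈n+n/2⌉ n) ⟨
    f (suc n) * f n                       ≡⟨ *-comm (f (suc n)) (f n) ⟩
    f n * f (suc n)                       ∎
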